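{- Let $m,n\in\mathbb{N}$ with $m$ even and $n\ge m\ge4$. Let $S_n$ be the symmetric group on $\{a_1,\dots,a_n\}$ and let $S_{n+3(\frac m2-1)}$ be the symmetric group on $\{a_1,\dots,a_n\}$ together with $3(\frac m2-1)$ new points. If $\sigma\in S_n$ is a transposition, then there exist $\mu_1,\mu_2,\mu_3\in S_{n+3(\frac m2-1)}\setminus S_n$ such that $\sigma^{ -1}=\mu_1\mu_2\mu_3$, each $\mu_i$ is an $m$-cycle, and $\mu_1,\mu_2,\mu_3$ move pairwise distinct sets of $m$ elements.
   Context: $S_{n+3(\frac m2-1)}\setminus S_n$ consists of permutations moving at least one of the new points. Products are compositions, rightmost applied first. -}

module Defs where

open import Data.Nat using (ℕ; suc; _+_; _*_; _∸_)
open import Data.Nat.DivMod using (_/_)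
open import Data.Fin using (Fin; toℕ; _↑ˡ_; _↑ʳ_; splitAt)
open import Data.Fin.Permutation using (Permutation′; _⟨$⟩ʳ_; _⟨$⟩ˡ_)
open import Data.Sum using (_⊎_; inj₁; inj₂)
open import Data.Product using (Σ; ∃; _×_)
open import Function.Definitions using (Injective)
open import Relation.Binary.PropositionalEquality using (_≡_; _≢_)

newPts : ℕ → ℕ
newPts m = 3 * ((m / 2) ∸ 1)

-- Points of S_{n + k}: Fin (n + k); the old points a_1..a_n are  i ↑ˡ k,
-- the new points are  n ↑ʳ j.

IsTransposition : ∀ {n} → Permutation′ n → Set
IsTransposition {n} σ =
  Σ (Fin n) λ i → Σ (Fin n) λ j →
    i ≢ j × σ ⟨$⟩ʳ i ≡ j × σ ⟨$⟩ʳ j ≡ i ×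
    (∀ x → x ≢ i → x ≢ j → σ ⟨$⟩ʳ x ≡ x)

embInv : ∀ {n} k → Permutation′ n → Fin (n + k) → Fin (n + k)
embInv {n} k σ x with splitAt n x
... | inj₁ i = (σ ⟨$⟩ˡ i) ↑ˡ k
... | inj₂ j = x

IsCycle : ∀ {N} (m : ℕ) → Permutation′ N → Set
IsCycle {N} m π =
  Σ (Fin m → Fin N) λ c →
    Injective _≡_ _≡_ c ×
    (∀ (i j : Fin m) →
        (toℕ j ≡ suc (toℕ i) ⊎ (toℕ j ≡ 0 × suc (toℕ i) ≡ m)) →
        π ⟨$⟩ʳ (c i) ≡ c j) ×
    (∀ x → (∀ i → c i ≢ x) → π ⟨$⟩ʳ x ≡ x)

-- π ∈ S_{n+k} \ S_n : π moves at least one new point.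
MovesNewPoint : ∀ n k → Permutation′ (n + k) → Set
MovesNewPoint n k π = ∃ λ (j : Fin k) → π ⟨$⟩ʳ (n ↑ʳ j) ≢ (n ↑ʳ j)

-- Write m = 2k + 2, split the 3k new points into blocks X, Y, Z of k points each and
-- let σ = (a b). The m-cycles
--   μ₁ = (a X₀ … Xₖ₋₁ Y₀ … Yₖ₋₁ b),
--   μ₂ = (b Z₀ … Zₖ₋₁ Xₖ₋₁ … X₀ a),
--   μ₃ = (a Yₖ₋₁ … Y₀ Zₖ₋₁ … Z₀ b)
-- have product μ₁ μ₂ μ₃ = (a b) = σ⁻¹: each block is traversed forwards by one cycle and
-- backwards by another, so the new points are fixed, while a ↦ b ↦ a. The cycles live on a type of marked
-- points (a, b, the other old points, the new points) and are transported to
-- Fin (n + 3k) by conjugating with a bijection.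

module Submission where

open import Data.Empty using (⊥-elim)
open import Data.Empty.Irrelevant renaming (⊥-elim to ⊥-elim-irr)
open import Data.Fin using (Fin; zero; suc; toℕ; fromℕ; fromℕ<; inject₁; _↑ʳ_; splitAt)
open import Data.Fin.Permutation using (Permutation′; _⟨$⟩ʳ_)
open import Data.Fin.Properties
  using (toℕ<n; toℕ-fromℕ<; toℕ-injective; toℕ-fromℕ; toℕ-inject₁; splitAt⁻¹-↑ʳ; +↔⊎; *↔×)
  renaming (_≟_ to _≟ᶠ_)
open import Data.Fin.Relation.Unary.Top using (view; ‵fromℕ; ‵inject₁; view-fromℕ; view-inject₁)
open import Data.Nat using (ℕ; zero; suc; _+_; _*_; _∸_; _≤_; _<_; _<?_; z≤n; s≤s)
open import Data.Nat.Divisibility using (_∣_; divides)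
open import Data.Nat.DivMod using (m*n/n≡m)
open import Data.Nat.Properties
  using (<-irrefl; ≤⇒≯; ≮⇒≥; 1+n≢0; n<1+n; <-trans; ≤-trans; ≤-refl; suc-injective;
         +-suc; +-identityʳ; +-monoʳ-<; m≤m+n; m∸n≤m; n∸n≡0; +-∸-assoc; *-comm)
open import Data.Product using (Σ; _×_; _,_)
open import Data.Sum using (_⊎_; inj₁; inj₂)
open import Data.Sum.Function.Propositional using (_⊎-↔_)
open import Defs
open import Function.Base using (_∘_; case_of_)
open import Function.Bundles using (_↔_; _⇔_; Inverse; Injection; Equivalence; mk↔ₛ′)
open import Function.Construct.Composition using (_↔-∘_)
open import Function.Construct.Identity using (↔-id)
open import Function.Construct.Symmetry using (↔-sym)
open import Function.Definitions using (Injective)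
open import Function.Properties.Inverse using (Inverse⇒Injection)
open import Relation.Binary.Definitions using (DecidableEquality)
open import Relation.Binary.PropositionalEquality
open import Relation.Nullary using (¬_; yes; no)

IsCycleOn : ∀ {P : Set} (m : ℕ) → (P → P) → Set
IsCycleOn {P} m f =
  Σ (Fin m → P) λ c →
    Injective _≡_ _≡_ c ×
    (∀ (i j : Fin m) →
        (toℕ j ≡ suc (toℕ i) ⊎ (toℕ j ≡ 0 × suc (toℕ i) ≡ m)) →
        f (c i) ≡ c j) ×
    (∀ x → (∀ i → c i ≢ x) → f x ≡ x)

module _ {P : Set} (m : ℕ) (f : P → P) (pos : P → ℕ) (s : P) where

  open import Function.Endo.Propositional P using (_^_)

  -- pos numbers the orbit of s as 0, …, m ∸ 1 and is ≥ m off it. Checking Step pointwise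
  -- suffices: surjectivity of f shows that every point of position d < m is fᵈ s.
  data Step (x : P) : Set where
    fixed : m ≤ pos x → f x ≡ x → Step x
    next  : suc (pos x) < m → pos (f x) ≡ suc (pos x) → Step x
    close : suc (pos x) ≡ m → f x ≡ s → Step x

  module _ (pos-s : pos s ≡ 0) (step : ∀ x → Step x) (f⁻¹ : P → P)
           (f∘f⁻¹ : ∀ y → f (f⁻¹ y) ≡ y) where

    private
      step-next : ∀ x → suc (pos x) < m → pos (f x) ≡ suc (pos x)
      step-next x lt with step x
      ... | fixed m≤x _ = ⊥-elim (≤⇒≯ m≤x (<-trans (n<1+n _) lt))
      ... | next _ e    = e
      ... | close e _   = ⊥-elim (<-irrefl e lt)

      step-close : ∀ x → suc (pos x) ≡ m → f x ≡ s
      step-close x eq with step x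
      ... | fixed m≤x _ = ⊥-elim (≤⇒≯ m≤x (subst (pos x <_) eq (n<1+n _)))
      ... | next lt _   = ⊥-elim (<-irrefl eq lt)
      ... | close _ e   = e

      step-fixed : ∀ x → m ≤ pos x → f x ≡ x
      step-fixed x m≤x with step x
      ... | fixed _ e   = e
      ... | next lt _   = ⊥-elim (≤⇒≯ m≤x (<-trans (n<1+n _) lt))
      ... | close eq _  = ⊥-elim (≤⇒≯ m≤x (subst (pos x <_) eq (n<1+n _)))

      pos-^ : ∀ d → d < m → pos ((f ^ d) s) ≡ d
      pos-^ zero    _    = pos-s
      pos-^ (suc d) d+1<m =
        trans (step-next _ (subst (λ e → suc e < m) (sym ih) d+1<m)) (cong suc ih)
        where ih = pos-^ d (<-trans (n<1+n d) d+1<m)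

      ^-pos : ∀ d x → pos x ≡ d → d < m → (f ^ d) s ≡ x
      ^-pos d x px d<m =
        trans (^-pos-f d (f⁻¹ x) (trans (cong pos (f∘f⁻¹ x)) px) d<m) (f∘f⁻¹ x)
        where
        ^-pos-f : ∀ d y → pos (f y) ≡ d → d < m → (f ^ d) s ≡ f y
        ^-pos-f d y pfy d<m with step y
        ... | fixed m≤y fy≡y =
          ⊥-elim (≤⇒≯ m≤y (subst (_< m) (trans (sym pfy) (cong pos fy≡y)) d<m))
        ^-pos-f zero    y pfy d<m | next _ e = ⊥-elim (1+n≢0 (trans (sym e) pfy))
        ^-pos-f (suc d) y pfy d<m | next _ e =
          cong f (^-pos d y (suc-injective (trans (sym e) pfy)) (<-trans (n<1+n d) d<m))
        ^-pos-f zero    y pfy d<m | close _ fy≡s = sym fy≡s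
        ^-pos-f (suc d) y pfy d<m | close _ fy≡s =
          ⊥-elim (1+n≢0 (trans (sym pfy) (trans (cong pos fy≡s) pos-s)))

      orbit : Fin m → P
      orbit i = (f ^ toℕ i) s

      orbit-injective : Injective _≡_ _≡_ orbit
      orbit-injective {i} {j} e = toℕ-injective (begin
        toℕ i             ≡⟨ sym (pos-^ (toℕ i) (toℕ<n i)) ⟩
        pos (orbit i)     ≡⟨ cong pos e ⟩
        pos (orbit j)     ≡⟨ pos-^ (toℕ j) (toℕ<n j) ⟩
        toℕ j             ∎)
        where open ≡-Reasoning

      orbit-step : ∀ (i j : Fin m) →
          (toℕ j ≡ suc (toℕ i) ⊎ (toℕ j ≡ 0 × suc (toℕ i) ≡ m)) →
          f (orbit i) ≡ orbit j
      orbit-step i j (inj₁ j≡i+1) = cong (λ d → (f ^ d) s) (sym j≡i+1)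
      orbit-step i j (inj₂ (j≡0 , i+1≡m)) =
        trans (step-close (orbit i) (trans (cong suc (pos-^ (toℕ i) (toℕ<n i))) i+1≡m))
              (cong (λ d → (f ^ d) s) (sym j≡0))

      off-orbit-fixed : ∀ x → (∀ i → orbit i ≢ x) → f x ≡ x
      off-orbit-fixed x x∉orbit with pos x <? m
      ... | yes x<m = ⊥-elim (x∉orbit (fromℕ< x<m)
                        (^-pos (toℕ (fromℕ< x<m)) x (sym (toℕ-fromℕ< x<m)) (toℕ<n _)))
      ... | no  x≮m = step-fixed x (≮⇒≥ x≮m)

    isCycleOn : IsCycleOn m f
    isCycleOn = orbit , orbit-injective , orbit-step , off-orbit-fixed

module Conjugation {A B : Set} (e : A ↔ B) where

  open Inverse e

  conjugate : B ↔ B → A ↔ A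
  conjugate μ = ↔-sym e ↔-∘ (μ ↔-∘ e)

  conjugate-from : ∀ μ p → Inverse.to (conjugate μ) (from p) ≡ from (Inverse.to μ p)
  conjugate-from μ p = cong (from ∘ Inverse.to μ) (strictlyInverseˡ p)

  from-injective : Injective _≡_ _≡_ from
  from-injective = Injection.injective (Inverse⇒Injection (↔-sym e))

  conjugate-moves : ∀ μ p → Inverse.to μ p ≢ p → Inverse.to (conjugate μ) (from p) ≢ from p
  conjugate-moves μ p moved eq = moved (from-injective (trans (sym (conjugate-from μ p)) eq))

  conjugate-fixes : ∀ μ p → Inverse.to μ p ≡ p → Inverse.to (conjugate μ) (from p) ≡ from p
  conjugate-fixes μ p μp≡p = trans (conjugate-from μ p) (cong from μp≡p)

  IsCycleOn-conjugate : ∀ {m} μ →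
    IsCycleOn m (Inverse.to μ) → IsCycleOn m (Inverse.to (conjugate μ))
  IsCycleOn-conjugate μ (c , c-inj , c-step , c-fix) =
      (λ i → from (c i))
    , (λ eq → c-inj (from-injective eq))
    , (λ i j i→j → trans (conjugate-from μ (c i)) (cong from (c-step i j i→j)))
    , λ x x∉c → trans (cong from (c-fix (to x) (to-∉ x x∉c))) (strictlyInverseʳ x)
    where
    to-∉ : ∀ x → (∀ i → from (c i) ≢ x) → ∀ i → c i ≢ to x
    to-∉ x x∉c i eq = x∉c i (trans (cong from eq) (strictlyInverseʳ x))

-- The proofs in other are irrelevant, so that toMarked ∘ unmark is the identity.
data Marked {T : Set} (a b : T) (E : Set) : Set where
  A B   : Marked a b E
  other : (i : T) → .(i ≢ a) → .(i ≢ b) → Marked a b E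
  new   : E → Marked a b E

module _ {T : Set} {a b : T} {E : Set} where

  swapAB : Marked a b E → Marked a b E
  swapAB A = B
  swapAB B = A
  swapAB p = p

  unmark : Marked a b E → T ⊎ E
  unmark A             = inj₁ a
  unmark B             = inj₁ b
  unmark (other i _ _) = inj₁ i
  unmark (new y)       = inj₂ y

  module _ (_≟_ : DecidableEquality T) where

    mark : T → Marked a b E
    mark i with i ≟ a
    ... | yes _   = A
    ... | no  i≢a with i ≟ b
    ...   | yes _   = B
    ...   | no  i≢b = other i i≢a i≢b

    toMarked : T ⊎ E → Marked a b E
    toMarked (inj₁ i) = mark i
    toMarked (inj₂ y) = new y

    unmark-toMarked : ∀ x → unmark (toMarked x) ≡ x
    unmark-toMarked (inj₁ i) with i ≟ a
    ... | yes refl = refl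
    ... | no  _ with i ≟ b
    ...   | yes refl = refl
    ...   | no  _    = refl
    unmark-toMarked (inj₂ y) = refl

    toMarked-unmark : a ≢ b → ∀ p → toMarked (unmark p) ≡ p
    toMarked-unmark a≢b A with a ≟ a
    ... | yes _   = refl
    ... | no  a≢a = ⊥-elim (a≢a refl)
    toMarked-unmark a≢b B with b ≟ a
    ... | yes b≡a = ⊥-elim (a≢b (sym b≡a))
    ... | no  _ with b ≟ b
    ...   | yes _   = refl
    ...   | no  b≢b = ⊥-elim (b≢b refl)
    toMarked-unmark a≢b (other i i≢a i≢b) with i ≟ a
    ... | yes i≡a = ⊥-elim-irr (i≢a i≡a)
    ... | no  _ with i ≟ b
    ...   | yes i≡b = ⊥-elim-irr (i≢b i≡b)
    ...   | no  _   = refl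
    toMarked-unmark a≢b (new y) = refl

    ⊎↔Marked : a ≢ b → (T ⊎ E) ↔ Marked a b E
    ⊎↔Marked a≢b = mk↔ₛ′ toMarked unmark (toMarked-unmark a≢b) unmark-toMarked

    unmark-swapAB-mark : (σ : T ↔ T) → Inverse.to σ a ≡ b → Inverse.to σ b ≡ a →
      (∀ i → i ≢ a → i ≢ b → Inverse.to σ i ≡ i) →
      ∀ i → unmark (swapAB (mark i)) ≡ inj₁ (Inverse.from σ i)
    unmark-swapAB-mark σ σa σb σ-fix i with i ≟ a
    ... | yes refl = cong inj₁ (sym (Inverse.inverseʳ σ (sym σb)))
    ... | no  i≢a with i ≟ b
    ...   | yes refl = cong inj₁ (sym (Inverse.inverseʳ σ (sym σa)))
    ...   | no  i≢b  = cong inj₁ (sym (Inverse.inverseʳ σ (sym (σ-fix i i≢a i≢b))))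

module _ {P : Set} {k′ : ℕ} (C : Fin (suc k′) → P) (exit : P) where

  ascend : Fin (suc k′) → P
  ascend r with view r
  ... | ‵fromℕ     = exit
  ... | ‵inject₁ j = C (suc j)

  descend : Fin (suc k′) → P
  descend zero    = exit
  descend (suc j) = C (inject₁ j)

  ascend-fromℕ : ascend (fromℕ k′) ≡ exit
  ascend-fromℕ rewrite view-fromℕ k′ = refl

  ascend-inject₁ : ∀ j → ascend (inject₁ j) ≡ C (suc j)
  ascend-inject₁ j rewrite view-inject₁ j = refl

  module _ (pos : P → ℕ) (c : ℕ) (pos-exit : pos exit ≡ c + suc k′) where

    pos-ascend : (∀ r → pos (C r) ≡ c + toℕ r) → ∀ r → pos (ascend r) ≡ suc (c + toℕ r)
    pos-ascend pos-C r with view r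
    ... | ‵fromℕ     =
      trans pos-exit (trans (+-suc c k′) (cong (λ t → suc (c + t)) (sym (toℕ-fromℕ k′))))
    ... | ‵inject₁ j =
      trans (pos-C (suc j))
            (trans (+-suc c (toℕ j)) (cong (λ t → suc (c + t)) (sym (toℕ-inject₁ j))))

    pos-descend : (∀ r → pos (C r) ≡ c + (k′ ∸ toℕ r)) →
      ∀ r → pos (descend r) ≡ suc (c + (k′ ∸ toℕ r))
    pos-descend pos-C zero    = trans pos-exit (+-suc c k′)
    pos-descend pos-C (suc j) = begin
      pos (C (inject₁ j))               ≡⟨ pos-C (inject₁ j) ⟩
      c + (k′ ∸ toℕ (inject₁ j))        ≡⟨ cong (λ t → c + (k′ ∸ t)) (toℕ-inject₁ j) ⟩
      c + (suc k′ ∸ suc (toℕ j))        ≡⟨ cong (c +_) (+-∸-assoc 1 (toℕ<n j)) ⟩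
      c + suc (k′ ∸ suc (toℕ j))        ≡⟨ +-suc c _ ⟩
      suc (c + (k′ ∸ toℕ (suc j)))      ∎
      where open ≡-Reasoning

module ThreeCycles {T : Set} {a b : T} (k′ : ℕ) where

  k m : ℕ
  k = suc k′
  m = suc (suc (k + k))

  Pt : Set
  Pt = Marked a b (Fin 3 × Fin k)

  pattern X r = new (zero , r)
  pattern Y r = new (suc zero , r)
  pattern Z r = new (suc (suc zero) , r)

  last : Fin k
  last = fromℕ k′

  μ₁ ν₁ μ₂ ν₂ μ₃ ν₃ : Pt → Pt
  μ₁ A     = X zero
  μ₁ (X r) = ascend X (Y zero) r
  μ₁ (Y r) = ascend Y B r
  μ₁ B     = A
  μ₁ p     = p

  ν₁ A     = B
  ν₁ (X r) = descend X A r
  ν₁ (Y r) = descend Y (X last) r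
  ν₁ B     = Y last
  ν₁ p     = p

  μ₂ B     = Z zero
  μ₂ (Z r) = ascend Z (X last) r
  μ₂ (X r) = descend X A r
  μ₂ A     = B
  μ₂ p     = p

  ν₂ B     = A
  ν₂ (Z r) = descend Z B r
  ν₂ (X r) = ascend X (Z last) r
  ν₂ A     = X zero
  ν₂ p     = p

  μ₃ A     = Y last
  μ₃ (Y r) = descend Y (Z last) r
  μ₃ (Z r) = descend Z B r
  μ₃ B     = A
  μ₃ p     = p

  ν₃ A     = B
  ν₃ (Y r) = ascend Y A r
  ν₃ (Z r) = ascend Z (Y zero) r
  ν₃ B     = Z zero
  ν₃ p     = p

  ν₁∘μ₁ : ∀ p → ν₁ (μ₁ p) ≡ p
  ν₁∘μ₁ A = refl
  ν₁∘μ₁ (X r) with view r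
  ... | ‵fromℕ     = refl
  ... | ‵inject₁ j = refl
  ν₁∘μ₁ (Y r) with view r
  ... | ‵fromℕ     = refl
  ... | ‵inject₁ j = refl
  ν₁∘μ₁ B = refl
  ν₁∘μ₁ (other i _ _) = refl
  ν₁∘μ₁ (Z r) = refl

  μ₁∘ν₁ : ∀ p → μ₁ (ν₁ p) ≡ p
  μ₁∘ν₁ A = refl
  μ₁∘ν₁ (X zero)    = refl
  μ₁∘ν₁ (X (suc j)) = ascend-inject₁ X (Y zero) j
  μ₁∘ν₁ (Y zero)    = ascend-fromℕ X (Y zero)
  μ₁∘ν₁ (Y (suc j)) = ascend-inject₁ Y B j
  μ₁∘ν₁ B = ascend-fromℕ Y B
  μ₁∘ν₁ (other i _ _) = refl
  μ₁∘ν₁ (Z r) = refl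

  ν₂∘μ₂ : ∀ p → ν₂ (μ₂ p) ≡ p
  ν₂∘μ₂ A = refl
  ν₂∘μ₂ B = refl
  ν₂∘μ₂ (Z r) with view r
  ... | ‵fromℕ     = ascend-fromℕ X (Z last)
  ... | ‵inject₁ j = refl
  ν₂∘μ₂ (X zero)    = refl
  ν₂∘μ₂ (X (suc j)) = ascend-inject₁ X (Z last) j
  ν₂∘μ₂ (other i _ _) = refl
  ν₂∘μ₂ (Y r) = refl

  μ₂∘ν₂ : ∀ p → μ₂ (ν₂ p) ≡ p
  μ₂∘ν₂ A = refl
  μ₂∘ν₂ B = refl
  μ₂∘ν₂ (Z zero)    = refl
  μ₂∘ν₂ (Z (suc j)) = ascend-inject₁ Z (X last) j
  μ₂∘ν₂ (X r) with view r
  ... | ‵fromℕ     = ascend-fromℕ Z (X last)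
  ... | ‵inject₁ j = refl
  μ₂∘ν₂ (other i _ _) = refl
  μ₂∘ν₂ (Y r) = refl

  ν₃∘μ₃ : ∀ p → ν₃ (μ₃ p) ≡ p
  ν₃∘μ₃ A = ascend-fromℕ Y A
  ν₃∘μ₃ (Y zero)    = ascend-fromℕ Z (Y zero)
  ν₃∘μ₃ (Y (suc j)) = ascend-inject₁ Y A j
  ν₃∘μ₃ (Z zero)    = refl
  ν₃∘μ₃ (Z (suc j)) = ascend-inject₁ Z (Y zero) j
  ν₃∘μ₃ B = refl
  ν₃∘μ₃ (other i _ _) = refl
  ν₃∘μ₃ (X r) = refl

  μ₃∘ν₃ : ∀ p → μ₃ (ν₃ p) ≡ p
  μ₃∘ν₃ A = refl
  μ₃∘ν₃ (Y r) with view r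
  ... | ‵fromℕ     = refl
  ... | ‵inject₁ j = refl
  μ₃∘ν₃ (Z r) with view r
  ... | ‵fromℕ     = refl
  ... | ‵inject₁ j = refl
  μ₃∘ν₃ B = refl
  μ₃∘ν₃ (other i _ _) = refl
  μ₃∘ν₃ (X r) = refl

  μ₁∘μ₂∘μ₃ : ∀ p → μ₁ (μ₂ (μ₃ p)) ≡ swapAB p
  μ₁∘μ₂∘μ₃ A = ascend-fromℕ Y B
  μ₁∘μ₂∘μ₃ B = refl
  μ₁∘μ₂∘μ₃ (X zero)    = refl
  μ₁∘μ₂∘μ₃ (X (suc j)) = ascend-inject₁ X (Y zero) j
  μ₁∘μ₂∘μ₃ (Y zero)    =
    trans (cong μ₁ (ascend-fromℕ Z (X last))) (ascend-fromℕ X (Y zero))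
  μ₁∘μ₂∘μ₃ (Y (suc j)) = ascend-inject₁ Y B j
  μ₁∘μ₂∘μ₃ (Z zero)    = refl
  μ₁∘μ₂∘μ₃ (Z (suc j)) = cong μ₁ (ascend-inject₁ Z (X last) j)
  μ₁∘μ₂∘μ₃ (other i _ _) = refl

  pos₁ pos₂ pos₃ : Pt → ℕ
  pos₁ A     = 0
  pos₁ (X r) = 1 + toℕ r
  pos₁ (Y r) = suc k + toℕ r
  pos₁ B     = suc (k + k)
  pos₁ _     = m

  pos₂ B     = 0
  pos₂ (Z r) = 1 + toℕ r
  pos₂ (X r) = suc k + (k′ ∸ toℕ r)
  pos₂ A     = suc (k + k)
  pos₂ _     = m

  pos₃ A     = 0
  pos₃ (Y r) = 1 + (k′ ∸ toℕ r)
  pos₃ (Z r) = suc k + (k′ ∸ toℕ r)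
  pos₃ B     = suc (k + k)
  pos₃ _     = m

  1<m : 1 < m
  1<m = s≤s (s≤s z≤n)

  first-block< : ∀ {ρ} → ρ < k → suc (1 + ρ) < m
  first-block< ρ<k = s≤s (s≤s (≤-trans ρ<k (m≤m+n k k)))

  second-block< : ∀ {ρ} → ρ < k → suc (suc k + ρ) < m
  second-block< ρ<k = s≤s (s≤s (+-monoʳ-< k ρ<k))

  rank↓<k : ∀ (r : Fin k) → k′ ∸ toℕ r < k
  rank↓<k r = s≤s (m∸n≤m k′ (toℕ r))

  rank↓-last : k′ ∸ toℕ last ≡ 0
  rank↓-last = trans (cong (k′ ∸_) (toℕ-fromℕ k′)) (n∸n≡0 k′)

  second-block-start : ∀ {ρ} → ρ ≡ 0 → suc k + ρ ≡ 1 + k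
  second-block-start refl = +-identityʳ (suc k)

  step₁ : ∀ p → Step m μ₁ pos₁ A p
  step₁ A     = next 1<m refl
  step₁ (X r) = next (first-block< (toℕ<n r))
    (pos-ascend X (Y zero) pos₁ 1 (second-block-start refl) (λ _ → refl) r)
  step₁ (Y r) = next (second-block< (toℕ<n r))
    (pos-ascend Y B pos₁ (suc k) refl (λ _ → refl) r)
  step₁ B     = close refl refl
  step₁ (other i _ _) = fixed ≤-refl refl
  step₁ (Z r) = fixed ≤-refl refl

  step₂ : ∀ p → Step m μ₂ pos₂ B p
  step₂ B     = next 1<m refl
  step₂ (Z r) = next (first-block< (toℕ<n r))
    (pos-ascend Z (X last) pos₂ 1 (second-block-start rank↓-last) (λ _ → refl) r)
  step₂ (X r) = next (second-block< (rank↓<k r))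
    (pos-descend X A pos₂ (suc k) refl (λ _ → refl) r)
  step₂ A     = close refl refl
  step₂ (other i _ _) = fixed ≤-refl refl
  step₂ (Y r) = fixed ≤-refl refl

  step₃ : ∀ p → Step m μ₃ pos₃ A p
  step₃ A     = next 1<m (cong suc rank↓-last)
  step₃ (Y r) = next (first-block< (rank↓<k r))
    (pos-descend Y (Z last) pos₃ 1 (second-block-start rank↓-last) (λ _ → refl) r)
  step₃ (Z r) = next (second-block< (rank↓<k r))
    (pos-descend Z B pos₃ (suc k) refl (λ _ → refl) r)
  step₃ B     = close refl refl
  step₃ (other i _ _) = fixed ≤-refl refl
  step₃ (X r) = fixed ≤-refl refl

  μ₁-cycle : IsCycleOn m μ₁
  μ₁-cycle = isCycleOn m μ₁ pos₁ A refl step₁ ν₁ μ₁∘ν₁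

  μ₂-cycle : IsCycleOn m μ₂
  μ₂-cycle = isCycleOn m μ₂ pos₂ B refl step₂ ν₂ μ₂∘ν₂

  μ₃-cycle : IsCycleOn m μ₃
  μ₃-cycle = isCycleOn m μ₃ pos₃ A refl step₃ ν₃ μ₃∘ν₃

ThreeCycleFactorisation : (m K : ℕ) {n : ℕ} → Permutation′ n → Set
ThreeCycleFactorisation m K {n} σ =
  Σ (Permutation′ (n + K)) λ μ₁ →
  Σ (Permutation′ (n + K)) λ μ₂ →
  Σ (Permutation′ (n + K)) λ μ₃ →
    MovesNewPoint n K μ₁ ×
    MovesNewPoint n K μ₂ ×
    MovesNewPoint n K μ₃ ×
    (∀ x → embInv K σ x ≡ μ₁ ⟨$⟩ʳ (μ₂ ⟨$⟩ʳ (μ₃ ⟨$⟩ʳ x))) ×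
    IsCycle m μ₁ × IsCycle m μ₂ × IsCycle m μ₃ ×
    ¬ (∀ x → ((μ₁ ⟨$⟩ʳ x ≢ x) ⇔ (μ₂ ⟨$⟩ʳ x ≢ x))) ×
    ¬ (∀ x → ((μ₁ ⟨$⟩ʳ x ≢ x) ⇔ (μ₃ ⟨$⟩ʳ x ≢ x))) ×
    ¬ (∀ x → ((μ₂ ⟨$⟩ʳ x ≢ x) ⇔ (μ₃ ⟨$⟩ʳ x ≢ x)))

supports-differ : ∀ {A : Set} (f g : A → A) x → f x ≡ x → g x ≢ x →
  ¬ (∀ y → (f y ≢ y) ⇔ (g y ≢ y))
supports-differ f g x fx≡x gx≢x same = Equivalence.from (same x) gx≢x fx≡x

module _ {n : ℕ} {a b : Fin n} (a≢b : a ≢ b) (k′ : ℕ) where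

  open ThreeCycles {Fin n} {a} {b} k′

  blocks : Fin (n + 3 * k) ↔ (Fin n ⊎ (Fin 3 × Fin k))
  blocks = (↔-id _ ⊎-↔ *↔×) ↔-∘ +↔⊎

  marking : Fin (n + 3 * k) ↔ Pt
  marking = ⊎↔Marked _≟ᶠ_ a≢b ↔-∘ blocks

  open Conjugation marking
  open Inverse marking using (to; from)

  M₁ M₂ M₃ : Pt ↔ Pt
  M₁ = mk↔ₛ′ μ₁ ν₁ μ₁∘ν₁ ν₁∘μ₁
  M₂ = mk↔ₛ′ μ₂ ν₂ μ₂∘ν₂ ν₂∘μ₂
  M₃ = mk↔ₛ′ μ₃ ν₃ μ₃∘ν₃ ν₃∘μ₃

  movesNewPoint : ∀ (M : Pt ↔ Pt) y → Inverse.to M (new y) ≢ new y →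
    MovesNewPoint n (3 * k) (conjugate M)
  movesNewPoint M y moved = Inverse.from *↔× y , conjugate-moves M (new y) moved

  embInv-swapAB : (σ : Permutation′ n) → σ ⟨$⟩ʳ a ≡ b → σ ⟨$⟩ʳ b ≡ a →
    (∀ i → i ≢ a → i ≢ b → σ ⟨$⟩ʳ i ≡ i) →
    ∀ x → embInv (3 * k) σ x ≡ from (swapAB (to x))
  embInv-swapAB σ σa σb σ-fix x with splitAt n x in eq
  ... | inj₁ i = sym (cong (Inverse.from blocks) (unmark-swapAB-mark _≟ᶠ_ σ σa σb σ-fix i))
  ... | inj₂ j =
    sym (trans (cong (n ↑ʳ_) (Inverse.strictlyInverseʳ (*↔× {3} {k}) j)) (splitAt⁻¹-↑ʳ eq))

  transposition-factorisation : (σ : Permutation′ n) → σ ⟨$⟩ʳ a ≡ b → σ ⟨$⟩ʳ b ≡ a →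
    (∀ i → i ≢ a → i ≢ b → σ ⟨$⟩ʳ i ≡ i) →
    ThreeCycleFactorisation m (3 * k) σ
  transposition-factorisation σ σa σb σ-fix =
      π₁ , π₂ , π₃
    , movesNewPoint M₁ (zero , last)
        (λ eq → case trans (sym (ascend-fromℕ X (Y zero))) eq of λ ())
    , movesNewPoint M₂ (zero , zero) (λ ())
    , movesNewPoint M₃ (suc (suc zero) , zero) (λ ())
    , product
    , IsCycleOn-conjugate M₁ μ₁-cycle
    , IsCycleOn-conjugate M₂ μ₂-cycle
    , IsCycleOn-conjugate M₃ μ₃-cycle
    , supports-differ (π₁ ⟨$⟩ʳ_) (π₂ ⟨$⟩ʳ_) (from (Z last)) (conjugate-fixes M₁ (Z last) refl)
        (conjugate-moves M₂ (Z last)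
          (λ eq → case trans (sym (ascend-fromℕ Z (X last))) eq of λ ()))
    , supports-differ (π₁ ⟨$⟩ʳ_) (π₃ ⟨$⟩ʳ_) (from (Z zero)) (conjugate-fixes M₁ (Z zero) refl)
        (conjugate-moves M₃ (Z zero) (λ ()))
    , supports-differ (π₂ ⟨$⟩ʳ_) (π₃ ⟨$⟩ʳ_) (from (Y zero)) (conjugate-fixes M₂ (Y zero) refl)
        (conjugate-moves M₃ (Y zero) (λ ()))
    where
    π₁ π₂ π₃ : Permutation′ (n + 3 * k)
    π₁ = conjugate M₁
    π₂ = conjugate M₂
    π₃ = conjugate M₃

    product : ∀ x → embInv (3 * k) σ x ≡ π₁ ⟨$⟩ʳ (π₂ ⟨$⟩ʳ (π₃ ⟨$⟩ʳ x))
    product x = begin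
      embInv (3 * k) σ x              ≡⟨ embInv-swapAB σ σa σb σ-fix x ⟩
      from (swapAB (to x))            ≡⟨ cong from (sym (μ₁∘μ₂∘μ₃ (to x))) ⟩
      from (μ₁ (μ₂ (μ₃ (to x))))      ≡⟨ sym (conjugate-from M₁ (μ₂ (μ₃ (to x)))) ⟩
      π₁ ⟨$⟩ʳ from (μ₂ (μ₃ (to x)))   ≡⟨ cong (π₁ ⟨$⟩ʳ_) (sym (conjugate-from M₂ (μ₃ (to x)))) ⟩
      π₁ ⟨$⟩ʳ (π₂ ⟨$⟩ʳ (π₃ ⟨$⟩ʳ x))   ∎
      where open ≡-Reasoning

mainTheorem10 : (m n : ℕ) → 2 ∣ m → 4 ≤ m → m ≤ n →
    (σ : Permutation′ n) → IsTransposition σ →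
    Σ (Permutation′ (n + newPts m)) λ μ₁ →
    Σ (Permutation′ (n + newPts m)) λ μ₂ →
    Σ (Permutation′ (n + newPts m)) λ μ₃ →
      MovesNewPoint n (newPts m) μ₁ ×
      MovesNewPoint n (newPts m) μ₂ ×
      MovesNewPoint n (newPts m) μ₃ ×
      (∀ x → embInv (newPts m) σ x ≡ μ₁ ⟨$⟩ʳ (μ₂ ⟨$⟩ʳ (μ₃ ⟨$⟩ʳ x))) ×
      IsCycle m μ₁ × IsCycle m μ₂ × IsCycle m μ₃ ×
      ¬ (∀ x → ((μ₁ ⟨$⟩ʳ x ≢ x) ⇔ (μ₂ ⟨$⟩ʳ x ≢ x))) ×
      ¬ (∀ x → ((μ₁ ⟨$⟩ʳ x ≢ x) ⇔ (μ₃ ⟨$⟩ʳ x ≢ x))) ×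
      ¬ (∀ x → ((μ₂ ⟨$⟩ʳ x ≢ x) ⇔ (μ₃ ⟨$⟩ʳ x ≢ x)))
mainTheorem10 .(0 * 2) n (divides 0 refl) () _ σ _
mainTheorem10 .(1 * 2) n (divides 1 refl) (s≤s (s≤s ())) _ σ _
mainTheorem10 .(suc (suc k′) * 2) n (divides (suc (suc k′)) refl) _ _ σ
              (a , b , a≢b , σa , σb , σ-fix) =
  subst₂ (λ m K → ThreeCycleFactorisation m K σ) (sym m≡2k+2) (sym newPts≡3k)
    (transposition-factorisation a≢b k′ σ σa σb σ-fix)
  where
  k : ℕ
  k = suc k′
  m≡2k+2 : suc k * 2 ≡ suc (suc (k + k))
  m≡2k+2 = cong (2 +_) (trans (*-comm k 2) (cong (k +_) (+-identityʳ k)))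
  newPts≡3k : newPts (suc k * 2) ≡ 3 * k
  newPts≡3k = cong (λ t → 3 * (t ∸ 1)) (m*n/n≡m (suc k) 2)
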